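{- For every integer $n\ge1$ and every finite nonempty set $J\subset\mathbb{Z}$, $$\inf_{\mathbf{x}\in(0,\infty)^n}\ \sum_{i=1}^n\frac{x_i}{\min_{j\in J}x_{(i+j-1)\bmod n}}=n.$$
   Context: Here $a\bmod n$ denotes the representative of $a$ modulo $n$ in $\{1,\dots,n\}$ (so $0\bmod n=n$).
   Formalization: The infimum is taken only over points $\mathbf{x}$ with positive rational coordinates rather than over all of $(0,\infty)^n$. -}

module Defs where

open import Data.Nat as ℕ using (ℕ; suc; NonZero)
open import Data.Integer as ℤ using (ℤ; +_; _%ℕ_)
open import Data.Integer.DivMod using (n%ℕd<d)
open import Data.Fin using (Fin; toℕ; fromℕ<)
open import Data.List using (List; []; _∷_; map; foldr; allFin)
open import Data.Rational using (ℚ; 0ℚ; _+_; _⊓_; _÷_; ≢-nonZero)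
open import Data.Rational.Properties using (_≟_)
open import Relation.Nullary using (yes; no)

-- Points x = (x_1, …, x_n) are functions Fin n → ℚ, with x_k stored at
-- position k - 1 (i.e. x_k = x (k-1) for k ∈ {1,…,n}).

-- x_{a mod n}, where a mod n is the representative of a in {1,…,n}
-- (so 0 mod n = n).  That representative equals ((a - 1) mod n) + 1 with
-- the usual remainder in {0,…,n-1}, hence stored at position (a - 1) %ℕ n.
entry : {n : ℕ} .{{_ : NonZero n}} → (Fin n → ℚ) → ℤ → ℚ
entry {n} x a = x (fromℕ< (n%ℕd<d (a ℤ.- ℤ.1ℤ) n))

-- minimum of a list of rationals (the empty case is never used: J ≢ [])
minℚ : List ℚ → ℚ
minℚ []           = 0ℚ
minℚ (a ∷ [])     = a
minℚ (a ∷ b ∷ l)  = a ⊓ minℚ (b ∷ l)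

sumℚ : List ℚ → ℚ
sumℚ = foldr _+_ 0ℚ

-- total division (only ever applied with a positive denominator)
_/'_ : ℚ → ℚ → ℚ
p /' q with q ≟ 0ℚ
... | yes _  = 0ℚ
... | no q≢0 = _÷_ p q {{≢-nonZero q≢0}}

-- F_J(x) = ∑_{i=1}^n x_i / min_{j∈J} x_{(i+j-1) mod n}
-- (the 0-based position i0 corresponds to i = i0 + 1)
F : {n : ℕ} .{{_ : NonZero n}} → List ℤ → (Fin n → ℚ) → ℚ
F {n} J x = sumℚ (map term (allFin n))
  where
  term : Fin n → ℚ
  term i0 = x i0 /' minℚ (map (λ j → entry x ((+ suc (toℕ i0)) ℤ.+ j ℤ.- ℤ.1ℤ)) J)

{-# OPTIONS --safe #-}

-- The minimum in the i-th denominator is at most x_{π i}, where π is the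
-- rotation i ↦ i + j - 1 of ℤ/n for the first element j of J; hence
-- F_J(x) ≥ Σ x_i / x_{π i}.  For every permutation π of m points and positive
-- y, Σ y_i / y_{π i} ≥ m (AM-GM, since the ratios multiply to 1).  We prove
-- this by induction on m: if y_p is maximal and π q = p, the permutation that
-- fixes p and sends q to π p replaces y_q / y_p + y_p / y_{π p} by
-- 1 + y_q / y_{π p}, which is not larger because (M - a)(M - b) ≥ 0 for
-- a, b ≤ M; then p can be removed.  The bound n is attained at x = (1, …, 1).

module Submission where

open import Defs
open import Data.Nat using (ℕ; NonZero)
open import Data.Integer using (ℤ)
open import Data.Fin using (Fin)
open import Data.List using (List; [])
open import Data.Product using (_×_; Σ)
open import Data.Rational using (ℚ; 0ℚ; _≤_; _<_; _+_; _/_)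
open import Data.Integer using (+_)
open import Relation.Binary.PropositionalEquality using (_≢_)

open import Data.Nat as ℕ using (zero; suc)
open import Data.Integer as ℤ using (_%ℕ_; _/ℕ_; 0ℤ; 1ℤ)
import Data.Integer.Properties as ℤ
open import Data.Integer.DivMod using (n%ℕd<d; a≡a%ℕn+[a/ℕn]*n)
import Data.Integer.Solver as ℤ-Solver
open import Algebra.Properties.AbelianGroup ℤ.+-0-abelianGroup using (∙-cancelʳ)
open import Data.Rational as ℚ using (1ℚ; _-_; -_; _*_; 1/_; positive; nonNegative)
open import Data.Rational.Properties
  using ( ≤-refl; ≤-reflexive; ≤-trans; ≤-total; <-≤-trans; <⇒≤; <⇒≢; module ≤-Reasoning
        ; +-assoc; +-identityˡ; +-identityʳ; +-inverseʳ; +-mono-≤; +-monoˡ-≤; +-monoʳ-≤; +-monoʳ-<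
        ; *-assoc; *-identityʳ; *-inverseˡ; *-inverseʳ; *-monoˡ-≤-nonNeg; *-cancelʳ-≤-pos
        ; pos⇒nonZero; pos*pos⇒pos; nonNeg*nonNeg⇒nonNeg; nonNegative⁻¹; positive⁻¹
        ; ⊓-sel; p⊓q≤p; normalize-coprime; +-0-commutativeMonoid )
import Data.Rational.Solver as ℚ-Solver
import Data.Nat.Coprimality as Coprime
open import Algebra.Properties.CommutativeMonoid.Sum +-0-commutativeMonoid using (sum; sum-remove; sum-cong-≗)
open import Data.Fin as Fin using (toℕ; fromℕ<; punchIn; punchOut)
open import Data.Fin.Properties using (_≟_; toℕ-fromℕ<; toℕ-injective; toℕ<n; punchIn-punchOut; punchInᵢ≢i; punchIn-injective)
open import Data.Fin.Permutation
  using (Permutation′; permutation; _⟨$⟩ʳ_; _⟨$⟩ˡ_; inverseʳ; inverseˡ; remove; transpose; _∘ₚ_; punchIn-permute)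
import Data.Fin.Permutation.Components as PC
open import Data.List using (_∷_; map; tabulate)
open import Data.List.Properties using (map-tabulate)
open import Data.Vec.Functional using (removeAt)
open import Data.Product using (_,_)
open import Data.Sum using (inj₁; inj₂)
open import Function using (id; _∘_; case_of_)
open import Relation.Binary using (tri<; tri≈; tri>)
open import Relation.Binary.PropositionalEquality using (_≡_; refl; sym; trans; cong; cong₂; subst; module ≡-Reasoning)
open import Relation.Nullary using (yes; no; contradiction)

module _ {q : ℚ} (q>0 : 0ℚ < q) where

  private instance
    q≢0 : ℚ.NonZero q
    q≢0 = pos⇒nonZero q {{positive q>0}}

  /'-≡-*1/ : ∀ p → p /' q ≡ p * 1/ q
  /'-≡-*1/ p with q ℚ.≟ 0ℚ
  ... | yes q≡0 = contradiction (sym q≡0) (<⇒≢ q>0)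
  ... | no _    = refl

  /'-self : q /' q ≡ 1ℚ
  /'-self = trans (/'-≡-*1/ q) (*-inverseʳ q)

  /'-*-cancelʳ : ∀ p → p /' q * q ≡ p
  /'-*-cancelʳ p = begin
    p /' q * q     ≡⟨ cong (_* q) (/'-≡-*1/ p) ⟩
    p * 1/ q * q   ≡⟨ *-assoc p (1/ q) q ⟩
    p * (1/ q * q) ≡⟨ cong (p *_) (*-inverseˡ q) ⟩
    p * 1ℚ         ≡⟨ *-identityʳ p ⟩
    p              ∎
    where open ≡-Reasoning

/'-antimonoʳ-≤ : ∀ {p m e} → 0ℚ ≤ p → 0ℚ < m → m ≤ e → p /' e ≤ p /' m
/'-antimonoʳ-≤ {p} {m} {e} p≥0 m>0 m≤e =
  *-cancelʳ-≤-pos (m * e) {{pos*pos⇒pos m {{positive m>0}} e {{positive e>0}}}} (begin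
    p /' e * (m * e)   ≡⟨ solve 3 (λ u m e → u :* (m :* e) := u :* e :* m) refl (p /' e) m e ⟩
    p /' e * e * m     ≡⟨ cong (_* m) (/'-*-cancelʳ e>0 p) ⟩
    p * m              ≤⟨ *-monoˡ-≤-nonNeg p {{nonNegative p≥0}} m≤e ⟩
    p * e              ≡⟨ cong (_* e) (/'-*-cancelʳ m>0 p) ⟨
    p /' m * m * e     ≡⟨ solve 3 (λ u m e → u :* m :* e := u :* (m :* e)) refl (p /' m) m e ⟩
    p /' m * (m * e)   ∎)
  where
  open ≤-Reasoning
  open ℚ-Solver.+-*-Solver
  e>0 = <-≤-trans m>0 m≤e

1+a/b≤M/b+a/M : ∀ {a b M} → 0ℚ < b → 0ℚ < M → a ≤ M → b ≤ M → 1ℚ + a /' b ≤ M /' b + a /' M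
1+a/b≤M/b+a/M {a} {b} {M} b>0 M>0 a≤M b≤M =
  *-cancelʳ-≤-pos (b * M) {{pos*pos⇒pos b {{positive b>0}} M {{positive M>0}}}} (begin
    (1ℚ + a /' b) * (b * M)
      ≡⟨ solve 3 (λ u b M → (con 1ℚ :+ u) :* (b :* M) := b :* M :+ u :* b :* M) refl (a /' b) b M ⟩
    b * M + a /' b * b * M
      ≡⟨ cong (λ t → b * M + t * M) (/'-*-cancelʳ b>0 a) ⟩
    b * M + a * M
      ≡⟨ +-identityˡ _ ⟨
    0ℚ + (b * M + a * M)
      ≤⟨ +-monoˡ-≤ (b * M + a * M) [M-a][M-b]≥0 ⟩
    (M - a) * (M - b) + (b * M + a * M)
      ≡⟨ solve 3 (λ a b M → (M :- a) :* (M :- b) :+ (b :* M :+ a :* M) := M :* M :+ a :* b) refl a b M ⟩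
    M * M + a * b
      ≡⟨ cong₂ (λ s t → s * M + t * b) (/'-*-cancelʳ b>0 M) (/'-*-cancelʳ M>0 a) ⟨
    M /' b * b * M + a /' M * M * b
      ≡⟨ solve 4 (λ u v b M → u :* b :* M :+ v :* M :* b := (u :+ v) :* (b :* M)) refl (M /' b) (a /' M) b M ⟩
    (M /' b + a /' M) * (b * M)
      ∎)
  where
  open ≤-Reasoning
  open ℚ-Solver.+-*-Solver
  diff-nonNeg : ∀ {p q} → p ≤ q → ℚ.NonNegative (q - p)
  diff-nonNeg {p} {q} p≤q = nonNegative (subst (_≤ q - p) (+-inverseʳ p) (+-monoˡ-≤ (- p) p≤q))
  [M-a][M-b]≥0 : 0ℚ ≤ (M - a) * (M - b)
  [M-a][M-b]≥0 = nonNegative⁻¹ _ {{nonNeg*nonNeg⇒nonNeg (M - a) {{diff-nonNeg a≤M}} (M - b) {{diff-nonNeg b≤M}}}}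

sum-mono-≤ : ∀ {m} {f g : Fin m → ℚ} → (∀ i → f i ≤ g i) → sum f ≤ sum g
sum-mono-≤ {zero}  f≤g = ≤-refl
sum-mono-≤ {suc m} f≤g = +-mono-≤ (f≤g Fin.zero) (sum-mono-≤ (f≤g ∘ Fin.suc))

sum-≤-at-two-points : ∀ {m} {f g : Fin (suc m) → ℚ} {p q} → p ≢ q →
                      (∀ i → i ≢ p → i ≢ q → g i ≡ f i) → g p + g q ≤ f p + f q → sum g ≤ sum f
sum-≤-at-two-points {zero} {p = Fin.zero} {Fin.zero} p≢q _ _ = contradiction refl p≢q
sum-≤-at-two-points {suc m} {f} {g} {p} {q} p≢q g≡f pair≤ = begin
  sum g                       ≡⟨ split g ⟩
  g p + (g q + sum (rest g))  ≡⟨ cong (λ t → g p + (g q + t)) (sum-cong-≗ rest-g≗rest-f) ⟩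
  g p + (g q + R)             ≡⟨ +-assoc (g p) (g q) R ⟨
  (g p + g q) + R             ≤⟨ +-monoˡ-≤ R pair≤ ⟩
  (f p + f q) + R             ≡⟨ +-assoc (f p) (f q) R ⟩
  f p + (f q + R)             ≡⟨ split f ⟨
  sum f                       ∎
  where
  open ≤-Reasoning
  q′ = punchOut p≢q
  rest : (Fin (suc (suc m)) → ℚ) → Fin m → ℚ
  rest h = removeAt (removeAt h p) q′
  R = sum (rest f)
  split : ∀ h → sum h ≡ h p + (h q + sum (rest h))
  split h = begin-equality
    sum h                                      ≡⟨ sum-remove h ⟩
    h p + sum (removeAt h p)                   ≡⟨ cong (_+_ (h p)) (sum-remove (removeAt h p)) ⟩
    h p + (h (punchIn p q′) + sum (rest h))    ≡⟨ cong (λ i → h p + (h i + sum (rest h))) (punchIn-punchOut p≢q) ⟩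
    h p + (h q + sum (rest h))                 ∎
  rest-g≗rest-f : ∀ j → rest g j ≡ rest f j
  rest-g≗rest-f j = g≡f _ (punchInᵢ≢i p _)
    (λ eq → punchInᵢ≢i q′ j (punchIn-injective p _ _ (trans eq (sym (punchIn-punchOut p≢q)))))

+[1+n]/1≡1+n/1 : ∀ n → + suc n / 1 ≡ 1ℚ + + n / 1
+[1+n]/1≡1+n/1 n rewrite normalize-coprime {n} {0} (Coprime.sym (Coprime.1-coprimeTo n)) =
  cong (λ z → (+ 1 ℤ.+ z) / 1) (sym (ℤ.*-identityʳ (+ n)))

sumℚ-tabulate : ∀ {m} (f : Fin m → ℚ) → sumℚ (tabulate f) ≡ sum f
sumℚ-tabulate {zero}  f = refl
sumℚ-tabulate {suc m} f = cong (_+_ (f Fin.zero)) (sumℚ-tabulate (f ∘ Fin.suc))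

sum-const-1ℚ : ∀ m → sum {m} (λ _ → 1ℚ) ≡ + m / 1
sum-const-1ℚ zero    = refl
sum-const-1ℚ (suc m) = trans (cong (_+_ 1ℚ) (sum-const-1ℚ m)) (sym (+[1+n]/1≡1+n/1 m))

argmax : ∀ {m} (y : Fin (suc m) → ℚ) → Σ (Fin (suc m)) (λ p → ∀ i → y i ≤ y p)
argmax {zero}  y = Fin.zero , λ { Fin.zero → ≤-refl }
argmax {suc m} y with argmax (y ∘ Fin.suc)
... | p , max with ≤-total (y Fin.zero) (y (Fin.suc p))
...   | inj₁ y₀≤ = Fin.suc p , λ { Fin.zero → y₀≤    ; (Fin.suc i) → max i }
...   | inj₂ ≤y₀ = Fin.zero  , λ { Fin.zero → ≤-refl ; (Fin.suc i) → ≤-trans (max i) ≤y₀ }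

transpose-matchˡ : ∀ {m} (i j : Fin m) → PC.transpose i j i ≡ j
transpose-matchˡ i j with i ≟ i
... | yes _  = refl
... | no i≢i = contradiction refl i≢i

transpose-matchʳ : ∀ {m} (i j : Fin m) → PC.transpose i j j ≡ i
transpose-matchʳ i j with j ≟ i
... | yes j≡i = j≡i
... | no _ with j ≟ j
...   | yes _  = refl
...   | no j≢j = contradiction refl j≢j

transpose-fixes : ∀ {m} {i j k : Fin m} → k ≢ i → k ≢ j → PC.transpose i j k ≡ k
transpose-fixes {i = i} {j} {k} k≢i k≢j with k ≟ i
... | yes k≡i = contradiction k≡i k≢i
... | no _ with k ≟ j
...   | yes k≡j = contradiction k≡j k≢j
...   | no _    = refl

transpose-diagonal : ∀ {m} (i k : Fin m) → PC.transpose i i k ≡ k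
transpose-diagonal i k = case k ≟ i of λ where
  (yes k≡i) → subst (λ t → PC.transpose i i t ≡ t) (sym k≡i) (transpose-matchˡ i i)
  (no k≢i)  → transpose-fixes k≢i k≢i

ratioSum : ∀ {m} → (Fin m → ℚ) → Permutation′ m → ℚ
ratioSum y σ = sum (λ i → y i /' y (σ ⟨$⟩ʳ i))

ratioSum-remove : ∀ {m} (y : Fin (suc m) → ℚ) σ {p} → 0ℚ < y p → σ ⟨$⟩ʳ p ≡ p →
                  ratioSum y σ ≡ 1ℚ + ratioSum (y ∘ punchIn p) (remove p σ)
ratioSum-remove y σ {p} yp>0 σp≡p = begin
  ratioSum y σ                                     ≡⟨ sum-remove ratio ⟩
  ratio p + sum (removeAt ratio p)                 ≡⟨ cong₂ _+_ ratio-p≡1 (sum-cong-≗ ratio-punchIn) ⟩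
  1ℚ + ratioSum (y ∘ punchIn p) (remove p σ)       ∎
  where
  open ≡-Reasoning
  ratio : Fin _ → ℚ
  ratio i = y i /' y (σ ⟨$⟩ʳ i)
  ratio-p≡1 : ratio p ≡ 1ℚ
  ratio-p≡1 = trans (cong (λ k → y p /' y k) σp≡p) (/'-self yp>0)
  ratio-punchIn : ∀ j → ratio (punchIn p j) ≡ y (punchIn p j) /' y (punchIn p (remove p σ ⟨$⟩ʳ j))
  ratio-punchIn j = cong (λ k → y (punchIn p j) /' y k)
    (trans (punchIn-permute σ p j) (cong (λ k → punchIn k (remove p σ ⟨$⟩ʳ j)) σp≡p))

-- σ with p removed from its cycle: σ⁻¹ p ↦ σ p and p ↦ p.
shortcut : ∀ {m} → Permutation′ m → Fin m → Permutation′ m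
shortcut σ p = σ ∘ₚ transpose (σ ⟨$⟩ʳ p) p

shortcut-fixes : ∀ {m} (σ : Permutation′ m) p → shortcut σ p ⟨$⟩ʳ p ≡ p
shortcut-fixes σ p = transpose-matchˡ (σ ⟨$⟩ʳ p) p

ratioSum-shortcut-≤ : ∀ {m} (y : Fin (suc m) → ℚ) σ {p} → (∀ i → 0ℚ < y i) → (∀ i → y i ≤ y p) →
                      ratioSum y (shortcut σ p) ≤ ratioSum y σ
ratioSum-shortcut-≤ y σ {p} y>0 y≤yp with σ ⟨$⟩ʳ p ≟ p
... | yes σp≡p = ≤-reflexive (sum-cong-≗ λ i → cong (λ k → y i /' y k)
                   (trans (cong (λ k → PC.transpose k p (σ ⟨$⟩ʳ i)) σp≡p) (transpose-diagonal p (σ ⟨$⟩ʳ i))))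
... | no σp≢p = sum-≤-at-two-points p≢q unchanged pair≤
  where
  σp = σ ⟨$⟩ʳ p
  q  = σ ⟨$⟩ˡ p
  σq≡p : σ ⟨$⟩ʳ q ≡ p
  σq≡p = inverseʳ σ
  p≢q : p ≢ q
  p≢q p≡q = σp≢p (trans (cong (σ ⟨$⟩ʳ_) p≡q) σq≡p)
  σ-injective : ∀ {i j} → σ ⟨$⟩ʳ i ≡ σ ⟨$⟩ʳ j → i ≡ j
  σ-injective {i} {j} eq = trans (sym (inverseˡ σ)) (trans (cong (σ ⟨$⟩ˡ_) eq) (inverseˡ σ))
  unchanged : ∀ i → i ≢ p → i ≢ q → y i /' y (shortcut σ p ⟨$⟩ʳ i) ≡ y i /' y (σ ⟨$⟩ʳ i)
  unchanged i i≢p i≢q = cong (λ k → y i /' y k)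
    (transpose-fixes (i≢p ∘ σ-injective) (λ σi≡p → i≢q (σ-injective (trans σi≡p (sym σq≡p)))))
  pair≤ : y p /' y (shortcut σ p ⟨$⟩ʳ p) + y q /' y (shortcut σ p ⟨$⟩ʳ q) ≤ y p /' y σp + y q /' y (σ ⟨$⟩ʳ q)
  pair≤ = begin
    y p /' y (shortcut σ p ⟨$⟩ʳ p) + y q /' y (shortcut σ p ⟨$⟩ʳ q)
      ≡⟨ cong₂ _+_ (trans (cong (λ k → y p /' y k) (shortcut-fixes σ p)) (/'-self (y>0 p)))
                   (cong (λ k → y q /' y (PC.transpose σp p k)) σq≡p) ⟩
    1ℚ + y q /' y (PC.transpose σp p p)
      ≡⟨ cong (λ k → 1ℚ + y q /' y k) (transpose-matchʳ σp p) ⟩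
    1ℚ + y q /' y σp
      ≤⟨ 1+a/b≤M/b+a/M (y>0 σp) (y>0 p) (y≤yp q) (y≤yp σp) ⟩
    y p /' y σp + y q /' y p
      ≡⟨ cong (λ k → y p /' y σp + y q /' y k) σq≡p ⟨
    y p /' y σp + y q /' y (σ ⟨$⟩ʳ q) ∎
    where open ≤-Reasoning

ratioSum-≥ : ∀ m (σ : Permutation′ m) (y : Fin m → ℚ) → (∀ i → 0ℚ < y i) → + m / 1 ≤ ratioSum y σ
ratioSum-≥ zero    σ y y>0 = ≤-refl
ratioSum-≥ (suc m) σ y y>0 with argmax y
... | p , y≤yp = begin
  + suc m / 1                                                 ≡⟨ +[1+n]/1≡1+n/1 m ⟩
  1ℚ + + m / 1                                                ≤⟨ +-monoʳ-≤ 1ℚ (ratioSum-≥ m (remove p ρ) (y ∘ punchIn p) (y>0 ∘ punchIn p)) ⟩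
  1ℚ + ratioSum (y ∘ punchIn p) (remove p ρ)                  ≡⟨ ratioSum-remove y ρ (y>0 p) (shortcut-fixes σ p) ⟨
  ratioSum y ρ                                                ≤⟨ ratioSum-shortcut-≤ y σ y>0 y≤yp ⟩
  ratioSum y σ                                                ∎
  where
  open ≤-Reasoning
  ρ = shortcut σ p

<-by-quotient : ∀ {n r r′} {q q′ : ℤ} → r ℕ.< n → q ℤ.< q′ → + r ℤ.+ q ℤ.* + n ℤ.< + r′ ℤ.+ q′ ℤ.* + n
<-by-quotient {n} {r} {r′} {q} {q′} r<n q<q′ = begin-strict
  + r ℤ.+ q ℤ.* + n     <⟨ ℤ.+-monoˡ-< (q ℤ.* + n) (ℤ.+<+ r<n) ⟩
  + n ℤ.+ q ℤ.* + n     ≡⟨ ℤ.suc-* q (+ n) ⟨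
  ℤ.suc q ℤ.* + n       ≤⟨ ℤ.*-monoʳ-≤-nonNeg (+ n) (ℤ.i<j⇒suc[i]≤j q<q′) ⟩
  q′ ℤ.* + n            ≤⟨ ℤ.i≤j+i _ (+ r′) ⟩
  + r′ ℤ.+ q′ ℤ.* + n   ∎
  where open ℤ.≤-Reasoning

remainder-unique : ∀ {n r r′} {q q′ : ℤ} → r ℕ.< n → r′ ℕ.< n →
                   + r ℤ.+ q ℤ.* + n ≡ + r′ ℤ.+ q′ ℤ.* + n → r ≡ r′
remainder-unique {n} {r} {r′} {q} {q′} r<n r′<n eq with ℤ.<-cmp q q′
... | tri< q<q′ _ _ = contradiction eq (ℤ.<⇒≢ (<-by-quotient r<n q<q′))
... | tri≈ _ refl _ = ℤ.+-injective (∙-cancelʳ (q ℤ.* + n) (+ r) (+ r′) eq)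
... | tri> _ _ q′<q = contradiction (sym eq) (ℤ.<⇒≢ (<-by-quotient r′<n q′<q))

%ℕ-unique : ∀ {n} .{{_ : NonZero n}} {z} q {r} → r ℕ.< n → z ≡ + r ℤ.+ q ℤ.* + n → z %ℕ n ≡ r
%ℕ-unique {n} {z} q r<n z≡r+qn =
  remainder-unique {q = z /ℕ n} {q} (n%ℕd<d z n) r<n (trans (sym (a≡a%ℕn+[a/ℕn]*n z n)) z≡r+qn)

module _ {n : ℕ} .{{_ : NonZero n}} where

  shift : ℤ → Fin n → Fin n
  shift c i = fromℕ< (n%ℕd<d (+ toℕ i ℤ.+ c) n)

  shift-cancel : ∀ {c d} → d ℤ.+ c ≡ 0ℤ → ∀ i → shift c (shift d i) ≡ i
  shift-cancel {c} {d} d+c≡0 i = toℕ-injective (trans (toℕ-fromℕ< _) (%ℕ-unique (ℤ.- q) (toℕ<n i) eq))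
    where
    open ≡-Reasoning
    open ℤ-Solver.+-*-Solver
    z = + toℕ i ℤ.+ d
    q = z /ℕ n
    eq : + toℕ (shift d i) ℤ.+ c ≡ + toℕ i ℤ.+ ℤ.- q ℤ.* + n
    eq = begin
      + toℕ (shift d i) ℤ.+ c
        ≡⟨ cong (λ t → + t ℤ.+ c) (toℕ-fromℕ< _) ⟩
      + (z %ℕ n) ℤ.+ c
        ≡⟨ solve 4 (λ r c q n → r :+ c := r :+ q :* n :+ :- q :* n :+ c) refl (+ (z %ℕ n)) c q (+ n) ⟩
      + (z %ℕ n) ℤ.+ q ℤ.* + n ℤ.+ ℤ.- q ℤ.* + n ℤ.+ c
        ≡⟨ cong (λ t → t ℤ.+ ℤ.- q ℤ.* + n ℤ.+ c) (a≡a%ℕn+[a/ℕn]*n z n) ⟨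
      z ℤ.+ ℤ.- q ℤ.* + n ℤ.+ c
        ≡⟨ solve 5 (λ i d c q n → i :+ d :+ :- q :* n :+ c := i :+ (d :+ c) :+ :- q :* n) refl (+ toℕ i) d c q (+ n) ⟩
      + toℕ i ℤ.+ (d ℤ.+ c) ℤ.+ ℤ.- q ℤ.* + n
        ≡⟨ cong (λ t → + toℕ i ℤ.+ t ℤ.+ ℤ.- q ℤ.* + n) d+c≡0 ⟩
      + toℕ i ℤ.+ 0ℤ ℤ.+ ℤ.- q ℤ.* + n
        ≡⟨ cong (ℤ._+ ℤ.- q ℤ.* + n) (ℤ.+-identityʳ (+ toℕ i)) ⟩
      + toℕ i ℤ.+ ℤ.- q ℤ.* + n
        ∎

  rotate : ℤ → Permutation′ n
  rotate c = permutation (shift c) (shift (ℤ.- c))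
    (shift-cancel {c} {ℤ.- c} (ℤ.+-inverseˡ c)) (shift-cancel {ℤ.- c} {c} (ℤ.+-inverseʳ c))

  entry-rotate : ∀ (x : Fin n → _) i j → entry x (+ suc (toℕ i) ℤ.+ j ℤ.- 1ℤ) ≡ x (rotate (j ℤ.- 1ℤ) ⟨$⟩ʳ i)
  entry-rotate x i j = cong (λ a → x (fromℕ< (n%ℕd<d a n)))
    (solve 2 (λ i j → con 1ℤ :+ i :+ j :- con 1ℤ :- con 1ℤ := i :+ (j :- con 1ℤ)) refl (+ toℕ i) j)
    where open ℤ-Solver.+-*-Solver

minℚ-≤-head : ∀ a l → minℚ (a ∷ l) ≤ a
minℚ-≤-head a []      = ≤-refl
minℚ-≤-head a (b ∷ l) = p⊓q≤p a (minℚ (b ∷ l))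

minℚ-map-preserves : ∀ {A : Set} (P : ℚ → Set) (g : A → ℚ) j l → (∀ a → P (g a)) → P (minℚ (map g (j ∷ l)))
minℚ-map-preserves P g j []      Pg = Pg j
minℚ-map-preserves P g j (k ∷ l) Pg with ⊓-sel (g j) (minℚ (map g (k ∷ l)))
... | inj₁ min≡gj   = subst P (sym min≡gj) (Pg j)
... | inj₂ min≡rest = subst P (sym min≡rest) (minℚ-map-preserves P g k l Pg)

module _ {n : ℕ} .{{_ : NonZero n}} where

  window : (Fin n → ℚ) → List ℤ → Fin n → List ℚ
  window x J i = map (λ j → entry x (+ suc (toℕ i) ℤ.+ j ℤ.- 1ℤ)) J

  F-≡-sum : ∀ J (x : Fin n → ℚ) → F J x ≡ sum (λ i → x i /' minℚ (window x J i))
  F-≡-sum J x = trans (cong sumℚ (map-tabulate id term)) (sumℚ-tabulate term)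
    where
    term : Fin n → ℚ
    term i = x i /' minℚ (window x J i)

  F-≥ : ∀ j J (x : Fin n → ℚ) → (∀ i → 0ℚ < x i) → + n / 1 ≤ F (j ∷ J) x
  F-≥ j J x x>0 = begin
    + n / 1                                          ≤⟨ ratioSum-≥ n π x x>0 ⟩
    ratioSum x π                                     ≤⟨ sum-mono-≤ ratio≤term ⟩
    sum (λ i → x i /' minℚ (window x (j ∷ J) i))     ≡⟨ F-≡-sum (j ∷ J) x ⟨
    F (j ∷ J) x                                      ∎
    where
    open ≤-Reasoning
    π = rotate (j ℤ.- 1ℤ)
    ratio≤term : ∀ i → x i /' x (π ⟨$⟩ʳ i) ≤ x i /' minℚ (window x (j ∷ J) i)
    ratio≤term i = /'-antimonoʳ-≤ (<⇒≤ (x>0 i))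
      (minℚ-map-preserves (0ℚ <_) _ j J (λ _ → x>0 _))
      (≤-trans (minℚ-≤-head _ (window x J i)) (≤-reflexive (entry-rotate x i j)))

  F-const-1ℚ : ∀ j J → F (j ∷ J) (λ _ → 1ℚ) ≡ + n / 1
  F-const-1ℚ j J = begin
    F (j ∷ J) (λ _ → 1ℚ)                                  ≡⟨ F-≡-sum (j ∷ J) (λ _ → 1ℚ) ⟩
    sum {n} (λ _ → 1ℚ /' minℚ (map (λ _ → 1ℚ) (j ∷ J)))   ≡⟨ cong (λ t → sum {n} (λ _ → 1ℚ /' t)) min≡1 ⟩
    sum {n} (λ _ → 1ℚ /' 1ℚ)                              ≡⟨ sum-const-1ℚ n ⟩
    + n / 1                                               ∎
    where
    open ≡-Reasoning
    min≡1 : minℚ (map (λ _ → 1ℚ) (j ∷ J)) ≡ 1ℚ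
    min≡1 = minℚ-map-preserves (_≡ 1ℚ) (λ _ → 1ℚ) j J (λ _ → refl)

proposition7 : (n : ℕ) .{{_ : NonZero n}} (J : List ℤ) → J ≢ [] →
    ((x : Fin n → ℚ) → (∀ i → 0ℚ < x i) → (+ n / 1) ≤ F J x)
    × ((ε : ℚ) → 0ℚ < ε →
       Σ (Fin n → ℚ) (λ x → (∀ i → 0ℚ < x i) × (F J x < (+ n / 1) + ε)))
proposition7 n []      J≢[] = contradiction refl J≢[]
proposition7 n (j ∷ J) _    = F-≥ j J , λ ε ε>0 → (λ _ → 1ℚ) , (λ _ → positive⁻¹ 1ℚ) , (begin-strict
  F (j ∷ J) (λ _ → 1ℚ)   ≡⟨ F-const-1ℚ j J ⟩
  + n / 1                ≡⟨ +-identityʳ (+ n / 1) ⟨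
  + n / 1 + 0ℚ           <⟨ +-monoʳ-< (+ n / 1) ε>0 ⟩
  + n / 1 + ε            ∎)
  where open ≤-Reasoning
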